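{- Let $m,n\ge1$ and let $h$ be a homomorphism from $\mathbf{Z}_{2m}$ into $\mathbf{Z}_{2n}$. Then $h$ is injective and $m\le n$. Furthermore, the only endomorphism of $\mathbf{Z}_{2n}$ is the identity map.
   Context: $\mathbf{Z}=(\mathbb{Z};\wedge,\vee,\to,\neg)$ is the Sugihara algebra of integers: lattice operations from the natural order, $\neg a=-a$, $a\to b=(-a)\vee b$ if $a\le b$ and $(-a)\wedge b$ otherwise. For $n\ge1$, $\mathbf{Z}_{2n}$ is the subalgebra on $\{a\mid -n\le a\le n\}\setminus\{0\}$. -}

module Defs where

open import Data.Nat using (ℕ)
open import Data.Integer using (ℤ; +_; -_; _≤_; _⊓_; _⊔_; _≤?_)
open import Data.Product using (_×_)
open import Relation.Nullary using (¬_; yes; no)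
open import Relation.Binary.PropositionalEquality using (_≡_)

_∧Z_ : ℤ → ℤ → ℤ
a ∧Z b = a ⊓ b

_∨Z_ : ℤ → ℤ → ℤ
a ∨Z b = a ⊔ b

¬Z : ℤ → ℤ
¬Z a = - a

_⇒Z_ : ℤ → ℤ → ℤ
a ⇒Z b with a ≤? b
... | yes _ = (- a) ⊔ b
... | no  _ = (- a) ⊓ b

-- Carrier of the subalgebra Z_{2n}: {a | -n ≤ a ≤ n} \ {0}
record Z2 (n : ℕ) : Set where
  constructor ⟨_,_,_,_⟩
  field
    val   : ℤ
    lower : - (+ n) ≤ val
    upper : val ≤ + n
    nz    : ¬ (val ≡ + 0)
open Z2 public

-- Operations of Z_{2n} are the restrictions of those of Z; a map between
-- subalgebras is a homomorphism iff it commutes with them on the underlying values.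
record IsHom {m n : ℕ} (h : Z2 m → Z2 n) : Set where
  field
    pres-∧ : (x y z : Z2 m) → val z ≡ val x ∧Z val y →
             val (h z) ≡ val (h x) ∧Z val (h y)
    pres-∨ : (x y z : Z2 m) → val z ≡ val x ∨Z val y →
             val (h z) ≡ val (h x) ∨Z val (h y)
    pres-⇒ : (x y z : Z2 m) → val z ≡ val x ⇒Z val y →
             val (h z) ≡ val (h x) ⇒Z val (h y)
    pres-¬ : (x z : Z2 m) → val z ≡ ¬Z (val x) →
             val (h z) ≡ ¬Z (val (h x))

-- Write the positive elements of Z_{2m} as k+1 with k < m.  A homomorphism h
-- satisfies h(a) = h(a → a) = h(a) → h(a) = |h(a)| on positive a, so it maps
-- positives to positives and defines an index map φ with h(k+1) = φ(k)+1;
-- since h commutes with ¬ it then sends -(k+1) to -(φ(k)+1).  For 0 < a < b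
-- we have b → a = -b, hence h(b) → h(a) = -h(b), which in Z forces
-- h(a) < h(b): the map φ is strictly increasing on {0,…,m-1} with values
-- below n.
module Submission where

open import Defs
open import Data.Nat using (ℕ; _≤_; _≥_)
open import Data.Product using (_×_)
open import Relation.Binary.PropositionalEquality using (_≡_)

open import Data.Nat using (zero; suc; _<_; _+_; _∸_; z≤n; s≤s; s≤s⁻¹)
import Data.Nat.Properties as ℕP
open import Data.Integer as ℤ using (ℤ; +_; -[1+_]; +≤+; -≤+)
import Data.Integer.Properties as ℤP
open import Data.Product using (_,_; proj₁; proj₂; ∃-syntax)
open import Data.Empty using (⊥-elim)
open import Function using (_∘_)
open import Relation.Nullary using (¬_; yes; no)
open import Relation.Binary using (tri<; tri≈; tri>)
open import Relation.Binary.PropositionalEquality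
  using (refl; sym; trans; cong; cong₂; subst; module ≡-Reasoning)

self-implication : (a : ℤ) → a ⇒Z a ≡ (ℤ.- a) ℤ.⊔ a
self-implication a with a ℤ.≤? a
... | yes _   = refl
... | no  a≰a = ⊥-elim (a≰a ℤP.≤-refl)

fixed-by-self-implication : (a : ℤ) → a ≡ a ⇒Z a → ¬ (a ≡ + 0) →
                            ∃[ j ] a ≡ + suc j
fixed-by-self-implication (+ zero)   _ a≢0 = ⊥-elim (a≢0 refl)
fixed-by-self-implication (+ suc j)  _ _   = j , refl
fixed-by-self-implication -[1+ j ] a≡a⇒a _
  with () ← trans a≡a⇒a (self-implication -[1+ j ])

descending-implication : {k l : ℕ} → k < l → (+ suc l) ⇒Z (+ suc k) ≡ -[1+ l ]
descending-implication {k} {l} k<l with (+ suc l) ℤ.≤? (+ suc k)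
... | yes (+≤+ (s≤s l≤k)) = ⊥-elim (ℕP.<⇒≱ k<l l≤k)
... | no  _               = refl

implication-negative⇒descending : {i j : ℕ} →
  (+ suc j) ⇒Z (+ suc i) ≡ -[1+ j ] → i < j
implication-negative⇒descending {i} {j} eq with (+ suc j) ℤ.≤? (+ suc i)
... | yes _   with () ← eq
... | no  j≰i = ℕP.≰⇒> (j≰i ∘ +≤+ ∘ s≤s)

module StrictlyIncreasing {m : ℕ} (f : (k : ℕ) → k < m → ℕ)
  (increasing : ∀ {k l} (p : k < m) (q : l < m) → k < l → f k p < f l q) where

  injective : ∀ {k l} (p : k < m) (q : l < m) → f k p ≡ f l q → k ≡ l
  injective {k} {l} p q fk≡fl with ℕP.<-cmp k l
  ... | tri< k<l _ _ = ⊥-elim (ℕP.<-irrefl fk≡fl (increasing p q k<l))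
  ... | tri≈ _ k≡l _ = k≡l
  ... | tri> _ _ l<k = ⊥-elim (ℕP.<-irrefl (sym fk≡fl) (increasing q p l<k))

  inflationary : (k : ℕ) (p : k < m) → k ≤ f k p
  inflationary zero    _ = z≤n
  inflationary (suc k) p =
    ℕP.≤-<-trans (inflationary k (ℕP.<⇒≤ p)) (increasing (ℕP.<⇒≤ p) p (ℕP.n<1+n k))

  -- If all values lie below n, then the segment is no longer than n:
  -- otherwise n itself would satisfy n ≤ f n < n.
  length-bounded : (n : ℕ) → (∀ k (p : k < m) → f k p < n) → m ≤ n
  length-bounded n below = ℕP.≮⇒≥ λ n<m →
    ℕP.<-irrefl refl (ℕP.≤-<-trans (inflationary n n<m) (below n n<m))

  module Endo (below : ∀ k (p : k < m) → f k p < m) where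

    -- The d values above k still fit below m, so f k leaves room for them.
    headroom : (d k : ℕ) (p : k < m) → k + d < m → f k p + d < m
    headroom zero    k p _ = subst (_< m) (sym (ℕP.+-identityʳ (f k p))) (below k p)
    headroom (suc d) k p k+1+d<m =
      subst (_< m) (sym (ℕP.+-suc (f k p) d))
        (ℕP.≤-<-trans (ℕP.+-monoˡ-≤ d (increasing p q (ℕP.n<1+n k)))
                      (headroom d (suc k) q next<m))
      where
      next<m : suc k + d < m
      next<m = subst (_< m) (ℕP.+-suc k d) k+1+d<m
      q : suc k < m
      q = ℕP.≤-<-trans (ℕP.m≤m+n (suc k) d) next<m

    deflationary : (k : ℕ) (p : k < m) → f k p ≤ k
    deflationary k p = s≤s⁻¹ (ℕP.+-cancelʳ-< d (f k p) (suc k) fk+d<k+1+d)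
      where
      d = m ∸ suc k
      k+1+d≡m : suc k + d ≡ m
      k+1+d≡m = ℕP.m+[n∸m]≡n p
      fk+d<k+1+d : f k p + d < suc k + d
      fk+d<k+1+d = subst (f k p + d <_) (sym k+1+d≡m)
                     (headroom d k p (ℕP.≤-reflexive k+1+d≡m))

    identity : (k : ℕ) (p : k < m) → f k p ≡ k
    identity k p = ℕP.≤-antisym (deflationary k p) (inflationary k p)

pos : {m : ℕ} (k : ℕ) → k < m → Z2 m
pos k k<m = ⟨ + suc k , ℤP.neg-≤-pos , +≤+ k<m , (λ ()) ⟩

neg : {m : ℕ} (k : ℕ) → k < m → Z2 m
neg k k<m = ⟨ -[1+ k ] , ℤP.neg-mono-≤ (+≤+ k<m) , -≤+ , (λ ()) ⟩

data Shape (m : ℕ) : ℤ → Set where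
  positive : (k : ℕ) → k < m → Shape m (+ suc k)
  negative : (k : ℕ) → k < m → Shape m -[1+ k ]

shape : {m : ℕ} (x : Z2 m) → Shape m (val x)
shape ⟨ + zero   , _  , _          , x≢0 ⟩ = ⊥-elim (x≢0 refl)
shape ⟨ + suc k  , _  , +≤+ k<m    , _   ⟩ = positive k k<m
shape {m} ⟨ -[1+ k ] , lo , _      , _   ⟩ =
  negative k (ℤP.drop‿+≤+ (ℤP.neg-cancel-≤ {+ m} {+ suc k} lo))

module Homomorphism {m n : ℕ} (h : Z2 m → Z2 n) (isHom : IsHom h) where
  open IsHom isHom

  -- h only depends on the value of its argument (x = x ∧ x).
  respects-val : (x y : Z2 m) → val x ≡ val y → val (h x) ≡ val (h y)
  respects-val x y x≡y = sym (begin
    val (h y)                 ≡⟨ pres-∧ x x y (trans (sym x≡y) (sym (ℤP.⊓-idem (val x)))) ⟩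
    val (h x) ℤ.⊓ val (h x)   ≡⟨ ℤP.⊓-idem (val (h x)) ⟩
    val (h x)                 ∎)
    where open ≡-Reasoning

  -- Positives go to positives, since they are the fixed points of a ↦ a → a.
  positive-image : (k : ℕ) (p : k < m) → ∃[ j ] val (h (pos k p)) ≡ + suc j
  positive-image k p =
    fixed-by-self-implication (val (h x))
      (pres-⇒ x x x (sym (self-implication (+ suc k)))) (nz (h x))
    where x = pos k p

  φ : (k : ℕ) → k < m → ℕ
  φ k p = proj₁ (positive-image k p)

  φ-pos : (k : ℕ) (p : k < m) → val (h (pos k p)) ≡ + suc (φ k p)
  φ-pos k p = proj₂ (positive-image k p)

  φ-neg : (k : ℕ) (p : k < m) → val (h (neg k p)) ≡ -[1+ φ k p ]
  φ-neg k p = trans (pres-¬ (pos k p) (neg k p) refl) (cong ℤ.-_ (φ-pos k p))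

  φ-below : (k : ℕ) (p : k < m) → φ k p < n
  φ-below k p = ℤP.drop‿+≤+ (subst (ℤ._≤ + n) (φ-pos k p) (upper (h (pos k p))))

  -- For k < l the identity (l+1) → (k+1) = -(l+1) is preserved by h.
  φ-increasing : ∀ {k l} (p : k < m) (q : l < m) → k < l → φ k p < φ l q
  φ-increasing {k} {l} p q k<l = implication-negative⇒descending (begin
    (+ suc (φ l q)) ⇒Z (+ suc (φ k p))      ≡⟨ sym (cong₂ _⇒Z_ (φ-pos l q) (φ-pos k p)) ⟩
    val (h (pos l q)) ⇒Z val (h (pos k p))  ≡⟨ sym (pres-⇒ (pos l q) (pos k p) (neg l q)
                                                  (sym (descending-implication k<l))) ⟩
    val (h (neg l q))                       ≡⟨ φ-neg l q ⟩
    -[1+ φ l q ]                            ∎)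
    where open ≡-Reasoning

  open StrictlyIncreasing φ φ-increasing

  image : {a : ℤ} → Shape m a → ℤ
  image (positive k p) = + suc (φ k p)
  image (negative k p) = -[1+ φ k p ]

  image-of-shape : (x : Z2 m) {a : ℤ} (s : Shape m a) → val x ≡ a → val (h x) ≡ image s
  image-of-shape x (positive k p) x≡a = trans (respects-val x (pos k p) x≡a) (φ-pos k p)
  image-of-shape x (negative k p) x≡a = trans (respects-val x (neg k p) x≡a) (φ-neg k p)

  image-correct : (x : Z2 m) → val (h x) ≡ image (shape x)
  image-correct x = image-of-shape x (shape x) refl

  -- Signs are preserved and φ is injective, so distinct shapes have distinct images.
  image-injective : {a b : ℤ} (s : Shape m a) (t : Shape m b) → image s ≡ image t → a ≡ b
  image-injective (positive k p) (positive l q) e =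
    cong (+_ ∘ suc) (injective p q (ℕP.suc-injective (ℤP.+-injective e)))
  image-injective (negative k p) (negative l q) e =
    cong -[1+_] (injective p q (ℤP.-[1+-injective e))
  image-injective (positive _ _) (negative _ _) ()
  image-injective (negative _ _) (positive _ _) ()

  h-injective : (x y : Z2 m) → val (h x) ≡ val (h y) → val x ≡ val y
  h-injective x y hx≡hy =
    image-injective (shape x) (shape y)
      (trans (sym (image-correct x)) (trans hx≡hy (image-correct y)))

  m≤n : m ≤ n
  m≤n = length-bounded n φ-below

-- An endomorphism of Z_{2n} has index map the identity, so it is the identity.
endomorphism-is-identity : {n : ℕ} (h : Z2 n → Z2 n) → IsHom h →
                           (x : Z2 n) → val (h x) ≡ val x
endomorphism-is-identity {n} h isHom x =
  trans (image-correct x) (image-fixed (shape x))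
  where
  open Homomorphism h isHom
  open StrictlyIncreasing.Endo φ φ-increasing φ-below

  image-fixed : {a : ℤ} (s : Shape n a) → image s ≡ a
  image-fixed (positive k p) = cong (+_ ∘ suc) (identity k p)
  image-fixed (negative k p) = cong -[1+_] (identity k p)

proposition2p2 :
    ((m n : ℕ) → m ≥ 1 → n ≥ 1 → (h : Z2 m → Z2 n) → IsHom h →
      ((x y : Z2 m) → val (h x) ≡ val (h y) → val x ≡ val y) × m ≤ n)
    × ((n : ℕ) → n ≥ 1 → (h : Z2 n → Z2 n) → IsHom h →
      (x : Z2 n) → val (h x) ≡ val x)
proposition2p2 =
    (λ m n _ _ h isHom → let open Homomorphism h isHom in h-injective , m≤n)
  , (λ n _ h isHom → endomorphism-is-identity h isHom)
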